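{- Let $G$ be a graph of order $n\geq 3$ such that $G\neq K_{\ell}\cup\overline{K_{n-\ell}}$ for every integer $\ell$ with $n\geq\ell\geq 3$. Then $\gamma(C(G))=h(G)$.
   Context: All graphs are finite, undirected and simple. The central graph $C(G)$ is obtained from $G$ by subdividing each edge of $G$ exactly once and joining every pair of vertices non-adjacent in $G$ by an edge. $\gamma$ denotes the domination number. For $S\subseteq V(G)$ let $N^*(S)=\{x\in V(G)\setminus S : S\subseteq N_G(x)\}$, and let $i(N^*(S))$ be the number of vertices $v\in V(G)\setminus S$ with $v\in N^*(S)$ such that $v$ is isolated in $G-S$. Define $h(G)=\min\{|S|+|E(G-S)|+i(N^*(S)) : \emptyset\neq S\subseteq V(G)\}$. $K_\ell\cup\overline{K_{n-\ell}}$ is the disjoint union of $K_\ell$ and $n-\ell$ isolated vertices (equal to $K_n$ when $\ell=n$). -}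

module Defs where

open import Data.Nat using (ℕ; zero; suc; _+_; _≤_; _<ᵇ_)
open import Data.Bool using (Bool; true; false; not; _∧_; _∨_; if_then_else_; T)
open import Data.Fin using (Fin; toℕ; _<_)
import Data.Fin as Fin
open import Data.Fin.Subset using (Subset; ∣_∣; Nonempty)
open import Data.Fin.Permutation using (Permutation′; _⟨$⟩ʳ_)
open import Data.Vec using (lookup)
open import Data.Product using (Σ; ∃; ∃-syntax; _×_; _,_)
open import Data.Sum using (_⊎_)
open import Data.Empty using (⊥)
open import Data.List using (List; length)
open import Data.List.Membership.Propositional using (_∈_)
open import Data.List.Relation.Unary.Unique.Propositional using (Unique)
open import Relation.Binary.PropositionalEquality using (_≡_; _≢_)
open import Relation.Nullary using (¬_)

record Graph (n : ℕ) : Set where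
  field
    adj    : Fin n → Fin n → Bool
    sym    : ∀ i j → adj i j ≡ adj j i
    irrefl : ∀ i → adj i i ≡ false
open Graph public

count : ∀ {n} → (Fin n → Bool) → ℕ
count {zero}  p = 0
count {suc n} p = (if p Fin.zero then 1 else 0) + count (λ i → p (Fin.suc i))

sumF : ∀ {n} → (Fin n → ℕ) → ℕ
sumF {zero}  f = 0
sumF {suc n} f = f Fin.zero + sumF (λ i → f (Fin.suc i))

-- K_ℓ ∪ (n-ℓ) isolated vertices, on Fin n: vertices 0..ℓ-1 form a clique.

KUnion : (n ℓ : ℕ) → Graph n
KUnion n ℓ = record
  { adj    = λ i j → not (toℕ i Data.Nat.≡ᵇ toℕ j) ∧ (toℕ i <ᵇ ℓ) ∧ (toℕ j <ᵇ ℓ)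
  ; sym    = symP
  ; irrefl = irr
  }
  where
  open import Data.Nat.Properties using (≡ᵇ⇒≡; ≡⇒≡ᵇ)
  open import Relation.Binary.PropositionalEquality using (refl; sym; trans; cong)
  open import Data.Bool.Properties using (∧-comm; ∧-assoc)
  ≡ᵇ-sym : ∀ a b → (a Data.Nat.≡ᵇ b) ≡ (b Data.Nat.≡ᵇ a)
  ≡ᵇ-sym zero zero = refl
  ≡ᵇ-sym zero (suc b) = refl
  ≡ᵇ-sym (suc a) zero = refl
  ≡ᵇ-sym (suc a) (suc b) = ≡ᵇ-sym a b
  ≡ᵇ-refl : ∀ a → (a Data.Nat.≡ᵇ a) ≡ true
  ≡ᵇ-refl zero = refl
  ≡ᵇ-refl (suc a) = ≡ᵇ-refl a
  symP : (i j : Fin n) →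
    not (toℕ i Data.Nat.≡ᵇ toℕ j) ∧ (toℕ i <ᵇ ℓ) ∧ (toℕ j <ᵇ ℓ) ≡
    not (toℕ j Data.Nat.≡ᵇ toℕ i) ∧ (toℕ j <ᵇ ℓ) ∧ (toℕ i <ᵇ ℓ)
  symP i j rewrite ≡ᵇ-sym (toℕ i) (toℕ j) | ∧-comm (toℕ i <ᵇ ℓ) (toℕ j <ᵇ ℓ) = refl
  irr : (i : Fin n) → not (toℕ i Data.Nat.≡ᵇ toℕ i) ∧ (toℕ i <ᵇ ℓ) ∧ (toℕ i <ᵇ ℓ) ≡ false
  irr i rewrite ≡ᵇ-refl (toℕ i) = refl

_≅_ : ∀ {n} → Graph n → Graph n → Set
_≅_ {n} G H = Σ (Permutation′ n) λ σ → ∀ i j → adj G (σ ⟨$⟩ʳ i) (σ ⟨$⟩ʳ j) ≡ adj H i j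

Edge : ∀ {n} → Graph n → Set
Edge {n} G = Σ (Fin n × Fin n) λ { (i , j) → i < j × T (adj G i j) }

-- Vertices of C(G): original vertices plus one subdivision vertex per edge.
CVertex : ∀ {n} → Graph n → Set
CVertex {n} G = Fin n ⊎ Edge G

CAdj : ∀ {n} (G : Graph n) → CVertex G → CVertex G → Set
CAdj G (Data.Sum.inj₁ u) (Data.Sum.inj₁ v) = u ≢ v × adj G u v ≡ false
CAdj G (Data.Sum.inj₁ u) (Data.Sum.inj₂ ((i , j) , _)) = u ≡ i ⊎ u ≡ j
CAdj G (Data.Sum.inj₂ ((i , j) , _)) (Data.Sum.inj₁ u) = u ≡ i ⊎ u ≡ j
CAdj G (Data.Sum.inj₂ _) (Data.Sum.inj₂ _) = ⊥

Dominating : {V : Set} → (V → V → Set) → List V → Set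
Dominating {V} A D = ∀ v → v ∈ D ⊎ (∃[ u ] (u ∈ D × A u v))

-- k is the domination number: minimum size of a dominating set
-- (sets represented as duplicate-free lists).
IsDominationNumber : {V : Set} → (V → V → Set) → ℕ → Set
IsDominationNumber {V} A k =
  (∃[ D ] (Dominating A D × Unique D × length D ≡ k)) ×
  (∀ D → Dominating A D → Unique D → k ≤ length D)

module _ {n : ℕ} (G : Graph n) (S : Subset n) where
  private
    inS : Fin n → Bool
    inS i = lookup S i

  edgesOutside : ℕ
  edgesOutside = sumF λ i → count λ j →
    (toℕ i <ᵇ toℕ j) ∧ not (inS i) ∧ not (inS j) ∧ adj G i j

  -- i(N*(S)): vertices v ∉ S adjacent to every vertex of S and
  -- isolated in G - S.
  isolatedNStar : ℕ
  isolatedNStar = count λ v →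
    not (inS v) ∧
    (count (λ u → inS u ∧ not (adj G v u)) Data.Nat.≡ᵇ 0) ∧
    (count (λ w → not (inS w) ∧ adj G v w) Data.Nat.≡ᵇ 0)

  hValue : ℕ
  hValue = ∣ S ∣ + edgesOutside + isolatedNStar

IsH : ∀ {n} → Graph n → ℕ → Set
IsH {n} G k =
  (∃[ S ] (Nonempty S × hValue G S ≡ k)) ×
  (∀ S → Nonempty S → k ≤ hValue G S)

-- For every nonempty S ⊆ V(G), the vertices of S, the subdivision vertices of the edges of G − S
-- and the vertices counted by i(N*(S)) dominate C(G), so γ(C(G)) ≤ h(G). Conversely, the h(S)
-- objects of a suitable S can be charged injectively to the elements of any dominating set D:
-- take S = V(G) ∩ D if it is nonempty; otherwise D contains every subdivision vertex, G has no
-- isolated vertex, and S is one end of a path of length two or, if G is a perfect matching, one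
-- end of each of two edges (this needs n ≥ 3).
module Submission where

open import Defs hiding (sym)
open import Data.Bool using (Bool; true; false; not; _∧_; if_then_else_; T)
open import Data.Bool.Properties using (T-≡; T-∧; T-not-≡; T-irrelevant; not-injective; not-¬; ¬-not) renaming (_≟_ to _≟ᵇ_)
open import Data.Empty using (⊥-elim)
open import Data.Fin using (Fin; zero; suc; toℕ; _<_)
open import Data.Fin.Properties using (_≟_; suc-injective; toℕ-injective; any?)
open import Data.Fin.Subset using (Subset; ∣_∣; Nonempty; ⁅_⁆; _∪_)
open import Data.Fin.Subset.Properties using (x∈⁅x⁆; x∈⁅y⁆⇒x≡y; nonempty?; x∈p∪q⁺; x∈p∪q⁻)
open import Data.List using (List; []; _∷_; _++_; map; length)
open import Data.List.Membership.Propositional using (_∈_; _∉_)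
open import Data.List.Membership.Propositional.Properties using (∈-map⁺; ∈-map⁻; ∈-++⁺ˡ; ∈-++⁺ʳ; ∈-++⁻; ∈-∃++)
open import Data.List.Properties using (length-map; length-++; length-++-sucʳ)
open import Data.List.Relation.Binary.Subset.Propositional using (_⊆_)
import Data.List.Relation.Unary.All as All
open import Data.List.Relation.Unary.All.Properties using (¬Any⇒All¬)
open import Data.List.Relation.Unary.AllPairs using ([]; _∷_)
open import Data.List.Relation.Unary.Any using (here; there)
import Data.List.Relation.Unary.Any as Any
open import Data.List.Relation.Unary.Unique.Propositional using (Unique)
open import Data.List.Relation.Unary.Unique.Propositional.Properties using (map⁺; ++⁺)
open import Data.Nat using (ℕ; zero; suc; _+_; _≤_; z≤n; s≤s; _<ᵇ_; _≡ᵇ_)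
open import Data.Nat.Properties using (≤-refl; ≤-trans; _≤?_; ≰⇒≥; +-assoc; <ᵇ⇒<; <⇒<ᵇ; ≡ᵇ⇒≡; ≡⇒≡ᵇ; <-irrelevant; <-cmp)
open import Data.Product using (Σ; ∃; ∃-syntax; _×_; _,_; proj₁; proj₂)
open import Data.Sum using (_⊎_; inj₁; inj₂; [_,_]′)
open import Data.Sum.Properties using (inj₁-injective; inj₂-injective)
open import Data.Unit using (tt)
open import Data.Vec using ([]; _∷_; lookup; tabulate)
open import Data.Vec.Properties using (lookup∘tabulate; lookup⇒[]=; []=⇒lookup)
open import Function using (_∘_; id)
open import Function.Bundles using (module Equivalence)
open Equivalence using (to; from)
open import Relation.Binary using (tri<; tri≈; tri>)
open import Relation.Binary.PropositionalEquality using (_≡_; _≢_; refl; sym; trans; cong; cong₂; subst; module ≡-Reasoning)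
open import Relation.Nullary using (¬_; ¬?; Dec; yes; no; does)
open import Relation.Nullary.Decidable using (dec-true; dec-false; map′; _×-dec_)
open import Relation.Unary using (Decidable)

private variable
  A : Set
  n : ℕ

Unique-⊆⇒length≤ : {xs ys : List A} → Unique xs → xs ⊆ ys → length xs ≤ length ys
Unique-⊆⇒length≤ {xs = []} _ _ = z≤n
Unique-⊆⇒length≤ {xs = x ∷ xs} (x∉xs ∷ !xs) xs⊆ys with ∈-∃++ (xs⊆ys (here refl))
... | us , vs , refl =
  subst (suc (length xs) ≤_) (sym (length-++-sucʳ us x vs)) (s≤s (Unique-⊆⇒length≤ !xs xs⊆us++vs))
  where
  xs⊆us++vs : xs ⊆ us ++ vs
  xs⊆us++vs y∈xs with ∈-++⁻ us (xs⊆ys (there y∈xs))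
  ... | inj₁ y∈us         = ∈-++⁺ˡ y∈us
  ... | inj₂ (here refl)  = ⊥-elim (All.lookup x∉xs y∈xs refl)
  ... | inj₂ (there y∈vs) = ∈-++⁺ʳ us y∈vs

Σ-T-≡ : {p : A → Bool} {x y : Σ A (T ∘ p)} → proj₁ x ≡ proj₁ y → x ≡ y
Σ-T-≡ {x = a , t} {y = .a , s} refl = cong (a ,_) (T-irrelevant t s)

consIf : (b : Bool) → (T b → A) → List A → List A
consIf true  f xs = f tt ∷ xs
consIf false f xs = xs

length-consIf : ∀ b (f : T b → A) xs → length (consIf b f xs) ≡ (if b then 1 else 0) + length xs
length-consIf true  f xs = refl
length-consIf false f xs = refl

∈-consIf⁺ˡ : ∀ b (f : T b → A) xs (t : T b) → f t ∈ consIf b f xs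
∈-consIf⁺ˡ true f xs t = here refl

∈-consIf⁺ʳ : ∀ b (f : T b → A) {xs x} → x ∈ xs → x ∈ consIf b f xs
∈-consIf⁺ʳ true  f x∈xs = there x∈xs
∈-consIf⁺ʳ false f x∈xs = x∈xs

consIf⁺ : ∀ b (f : T b → A) {xs} → (∀ t → f t ∉ xs) → Unique xs → Unique (consIf b f xs)
consIf⁺ true  f f∉xs !xs = ¬Any⇒All¬ _ (f∉xs tt) ∷ !xs
consIf⁺ false f f∉xs !xs = !xs

witnesses : (p : Fin n → Bool) → List (Σ (Fin n) (T ∘ p))
witnesses {zero}  p = []
witnesses {suc n} p = consIf (p zero) (zero ,_) (map (λ (i , t) → suc i , t) (witnesses (p ∘ suc)))

length-witnesses : (p : Fin n → Bool) → length (witnesses p) ≡ count p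
length-witnesses {zero}  p = refl
length-witnesses {suc n} p = trans (length-consIf (p zero) _ _)
  (cong ((if p zero then 1 else 0) +_) (trans (length-map _ (witnesses (p ∘ suc))) (length-witnesses (p ∘ suc))))

∈-witnesses : (p : Fin n → Bool) (i : Fin n) (t : T (p i)) → (i , t) ∈ witnesses p
∈-witnesses p zero    t = ∈-consIf⁺ˡ (p zero) _ _ t
∈-witnesses p (suc i) t = ∈-consIf⁺ʳ (p zero) _ (∈-map⁺ _ (∈-witnesses (p ∘ suc) i t))

witnesses-Unique : (p : Fin n → Bool) → Unique (witnesses p)
witnesses-Unique {zero}  p = []
witnesses-Unique {suc n} p =
  consIf⁺ (p zero) _ zero∉ (map⁺ (λ { refl → refl }) (witnesses-Unique (p ∘ suc)))
  where
  zero∉ : ∀ t → (zero , t) ∉ map (λ (i , t) → suc i , t) (witnesses (p ∘ suc))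
  zero∉ t m with ∈-map⁻ _ m
  ... | _ , _ , ()

concatFin : (Fin n → List A) → List A
concatFin {zero}  f = []
concatFin {suc n} f = f zero ++ concatFin (f ∘ suc)

length-concatFin : (f : Fin n → List A) → length (concatFin f) ≡ sumF (length ∘ f)
length-concatFin {zero}  f = refl
length-concatFin {suc n} f =
  trans (length-++ (f zero)) (cong (length (f zero) +_) (length-concatFin (f ∘ suc)))

∈-concatFin⁺ : (f : Fin n → List A) (i : Fin n) {x : A} → x ∈ f i → x ∈ concatFin f
∈-concatFin⁺ f zero    x∈ = ∈-++⁺ˡ x∈
∈-concatFin⁺ f (suc i) x∈ = ∈-++⁺ʳ (f zero) (∈-concatFin⁺ (f ∘ suc) i x∈)

∈-concatFin⁻ : (f : Fin n → List A) {x : A} → x ∈ concatFin f → ∃ λ i → x ∈ f i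
∈-concatFin⁻ {suc n} f x∈ with ∈-++⁻ (f zero) x∈
... | inj₁ x∈f0 = zero , x∈f0
... | inj₂ x∈fs with ∈-concatFin⁻ (f ∘ suc) x∈fs
...   | i , x∈fi = suc i , x∈fi

concatFin-Unique : (f : Fin n → List A) → (∀ i → Unique (f i)) →
  (∀ {i j x} → x ∈ f i → x ∈ f j → i ≡ j) → Unique (concatFin f)
concatFin-Unique {zero}  f !f disj = []
concatFin-Unique {suc n} f !f disj =
  ++⁺ (!f zero) (concatFin-Unique (f ∘ suc) (!f ∘ suc) (λ x∈ x∈′ → suc-injective (disj x∈ x∈′))) disj₀
  where
  disj₀ : ∀ {x} → ¬ (x ∈ f zero × x ∈ concatFin (f ∘ suc))
  disj₀ (x∈f0 , x∈fs) with ∈-concatFin⁻ (f ∘ suc) x∈fs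
  ... | i , x∈fi with disj x∈f0 x∈fi
  ...   | ()

sumF-cong : {f g : Fin n → ℕ} → (∀ i → f i ≡ g i) → sumF f ≡ sumF g
sumF-cong {zero}  f≗g = refl
sumF-cong {suc n} f≗g = cong₂ _+_ (f≗g zero) (sumF-cong (f≗g ∘ suc))

count≡0⇒ : (p : Fin n → Bool) → count p ≡ 0 → ∀ i → p i ≡ false
count≡0⇒ {suc n} p c i with p zero in p0
count≡0⇒ {suc n} p () i       | true
count≡0⇒ {suc n} p c zero    | false = p0
count≡0⇒ {suc n} p c (suc i) | false = count≡0⇒ (p ∘ suc) c i

count-≡0 : (p : Fin n → Bool) → (∀ i → p i ≡ false) → count p ≡ 0
count-≡0 {zero}  p _ = refl
count-≡0 {suc n} p h rewrite h zero = count-≡0 (p ∘ suc) (h ∘ suc)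

∣S∣≡count : (S : Subset n) → ∣ S ∣ ≡ count (lookup S)
∣S∣≡count []          = refl
∣S∣≡count (true ∷ S)  = cong suc (∣S∣≡count S)
∣S∣≡count (false ∷ S) = ∣S∣≡count S

argmin-Subset : {P : Subset n → Set} → Decidable P → (f : Subset n → ℕ) →
  (∀ S → ¬ P S) ⊎ (∃ λ S → P S × (∀ S′ → P S′ → f S ≤ f S′))
argmin-Subset {zero} P? f with P? []
... | yes p = inj₂ ([] , p , λ { [] _ → ≤-refl })
... | no ¬p = inj₁ λ { [] → ¬p }
argmin-Subset {suc n} P? f
  with argmin-Subset (P? ∘ (true ∷_)) (f ∘ (true ∷_)) | argmin-Subset (P? ∘ (false ∷_)) (f ∘ (false ∷_))
... | inj₁ ¬in | inj₁ ¬out = inj₁ λ { (true ∷ S) → ¬in S ; (false ∷ S) → ¬out S }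
... | inj₂ (S , p , min) | inj₁ ¬out =
  inj₂ (true ∷ S , p , λ { (true ∷ S′) p′ → min S′ p′ ; (false ∷ S′) p′ → ⊥-elim (¬out S′ p′) })
... | inj₁ ¬in | inj₂ (S , p , min) =
  inj₂ (false ∷ S , p , λ { (true ∷ S′) p′ → ⊥-elim (¬in S′ p′) ; (false ∷ S′) p′ → min S′ p′ })
... | inj₂ (S , p , min) | inj₂ (R , q , minR) with f (true ∷ S) ≤? f (false ∷ R)
...   | yes S≤R =
  inj₂ (true ∷ S , p , λ { (true ∷ S′) p′ → min S′ p′ ; (false ∷ S′) p′ → ≤-trans S≤R (minR S′ p′) })
...   | no  S≰R =
  inj₂ (false ∷ R , q , λ { (true ∷ S′) p′ → ≤-trans (≰⇒≥ S≰R) (min S′ p′) ; (false ∷ S′) p′ → minR S′ p′ })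

∧≡false : ∀ {a b} → a ≡ true → a ∧ b ≡ false → b ≡ false
∧≡false refl b≡false = b≡false

lookup-⁅x⁆ : (x : Fin n) → lookup ⁅ x ⁆ x ≡ true
lookup-⁅x⁆ x = []=⇒lookup (x∈⁅x⁆ x)

lookup-⁅y⁆ : ∀ {x} (y : Fin n) → lookup ⁅ y ⁆ x ≡ true → x ≡ y
lookup-⁅y⁆ {x = x} y x∈ = x∈⁅y⁆⇒x≡y y (lookup⇒[]= x ⁅ y ⁆ x∈)

lookup-∪⁺ˡ : ∀ (p q : Subset n) {x} → lookup p x ≡ true → lookup (p ∪ q) x ≡ true
lookup-∪⁺ˡ p q {x} x∈p = []=⇒lookup (x∈p∪q⁺ (inj₁ (lookup⇒[]= x p x∈p)))

lookup-∪⁺ʳ : ∀ (p q : Subset n) {x} → lookup q x ≡ true → lookup (p ∪ q) x ≡ true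
lookup-∪⁺ʳ p q {x} x∈q = []=⇒lookup (x∈p∪q⁺ {p = p} (inj₂ (lookup⇒[]= x q x∈q)))

lookup-∪⁻ : ∀ (p q : Subset n) {x} → lookup (p ∪ q) x ≡ true → lookup p x ≡ true ⊎ lookup q x ≡ true
lookup-∪⁻ p q {x} x∈ with x∈p∪q⁻ p q (lookup⇒[]= x (p ∪ q) x∈)
... | inj₁ x∈p = inj₁ ([]=⇒lookup x∈p)
... | inj₂ x∈q = inj₂ ([]=⇒lookup x∈q)

module _ {n : ℕ} (G : Graph n) where

  adj-sym : ∀ {u w} → adj G u w ≡ true → adj G w u ≡ true
  adj-sym {u} {w} uw = trans (Graph.sym G w u) uw

  adj⇒≢ : ∀ {u w} → adj G u w ≡ true → u ≢ w
  adj⇒≢ {u} uu refl = not-¬ uu (irrefl G u)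

  _∈ₑ_ : Fin n → Edge G → Set
  x ∈ₑ ((i , j) , _) = x ≡ i ⊎ x ≡ j

  CAdj⇒∈ₑ : ∀ e {x} → CAdj G (inj₂ e) (inj₁ x) → x ∈ₑ e
  CAdj⇒∈ₑ ((i , j) , _) c = c

  CAdj⇒∈ₑ′ : ∀ e {x} → CAdj G (inj₁ x) (inj₂ e) → x ∈ₑ e
  CAdj⇒∈ₑ′ ((i , j) , _) c = c

  ∈ₑ⇒CAdj : ∀ e {x} → x ∈ₑ e → CAdj G (inj₂ e) (inj₁ x)
  ∈ₑ⇒CAdj ((i , j) , _) x∈e = x∈e

  Edge-≡ : {e e′ : Edge G} → proj₁ e ≡ proj₁ e′ → e ≡ e′
  Edge-≡ {_ , i<j , ij} {_ , i<j′ , ij′} refl =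
    cong₂ (λ p q → _ , p , q) (<-irrelevant i<j i<j′) (T-irrelevant ij ij′)

  edgeBetween : ∀ u w → adj G u w ≡ true → Σ (Edge G) λ e → u ∈ₑ e × w ∈ₑ e
  edgeBetween u w uw with <-cmp (toℕ u) (toℕ w)
  ... | tri< u<w _ _ = ((u , w) , u<w , from T-≡ uw) , inj₁ refl , inj₂ refl
  ... | tri≈ _ u≡w _ = ⊥-elim (adj⇒≢ uw (toℕ-injective u≡w))
  ... | tri> _ _ w<u = ((w , u) , w<u , from T-≡ (adj-sym uw)) , inj₂ refl , inj₁ refl

  ∈ₑ-adj : ∀ e {x y} → x ∈ₑ e → y ∈ₑ e → x ≢ y → adj G x y ≡ true
  ∈ₑ-adj (_ , _ , ij) (inj₁ refl) (inj₁ refl) x≢y = ⊥-elim (x≢y refl)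
  ∈ₑ-adj (_ , _ , ij) (inj₁ refl) (inj₂ refl) x≢y = to T-≡ ij
  ∈ₑ-adj (_ , _ , ij) (inj₂ refl) (inj₁ refl) x≢y = adj-sym (to T-≡ ij)
  ∈ₑ-adj (_ , _ , ij) (inj₂ refl) (inj₂ refl) x≢y = ⊥-elim (x≢y refl)

  ∈ₑ-two : ∀ e {x v w} → x ∈ₑ e → v ∈ₑ e → w ∈ₑ e → v ≢ w → x ≡ v ⊎ x ≡ w
  ∈ₑ-two e (inj₁ refl) (inj₁ refl) _           v≢w = inj₁ refl
  ∈ₑ-two e (inj₁ refl) (inj₂ refl) (inj₁ refl) v≢w = inj₂ refl
  ∈ₑ-two e (inj₁ refl) (inj₂ refl) (inj₂ refl) v≢w = ⊥-elim (v≢w refl)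
  ∈ₑ-two e (inj₂ refl) (inj₂ refl) _           v≢w = inj₁ refl
  ∈ₑ-two e (inj₂ refl) (inj₁ refl) (inj₂ refl) v≢w = inj₂ refl
  ∈ₑ-two e (inj₂ refl) (inj₁ refl) (inj₁ refl) v≢w = ⊥-elim (v≢w refl)

  otherEnd : ∀ e {x} → x ∈ₑ e → ∃ λ y → y ∈ₑ e × adj G x y ≡ true
  otherEnd ((i , j) , _ , ij) (inj₁ refl) = j , inj₂ refl , to T-≡ ij
  otherEnd ((i , j) , _ , ij) (inj₂ refl) = i , inj₁ refl , adj-sym (to T-≡ ij)

  vertexOf : {P : Fin n → Set} → Σ (Fin n) P → CVertex G
  vertexOf = inj₁ ∘ proj₁

  module _ (S : Subset n) where

    -- Definitionally, isoNStar and outsideEdge? are the predicates counted by isolatedNStar G S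
    -- and edgesOutside G S.
    isoNStar : Fin n → Bool
    isoNStar v = not (lookup S v)
      ∧ (count (λ u → lookup S u ∧ not (adj G v u)) ≡ᵇ 0)
      ∧ (count (λ w → not (lookup S w) ∧ adj G v w) ≡ᵇ 0)

    private
      isoNStar⁻ : ∀ {v} → T (isoNStar v) →
        lookup S v ≡ false × count (λ u → lookup S u ∧ not (adj G v u)) ≡ 0 ×
        count (λ w → not (lookup S w) ∧ adj G v w) ≡ 0
      isoNStar⁻ t with to T-∧ t
      ... | v∉S , t′ with to T-∧ t′
      ...   | c₁ , c₂ = to T-not-≡ v∉S , ≡ᵇ⇒≡ _ 0 c₁ , ≡ᵇ⇒≡ _ 0 c₂

    isoNStar⇒∉ : ∀ {v} → T (isoNStar v) → lookup S v ≡ false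
    isoNStar⇒∉ = proj₁ ∘ isoNStar⁻

    isoNStar⇒adj : ∀ {v u} → T (isoNStar v) → lookup S u ≡ true → adj G v u ≡ true
    isoNStar⇒adj {v} {u} t u∈S =
      not-injective (∧≡false u∈S (count≡0⇒ _ (proj₁ (proj₂ (isoNStar⁻ t))) u))

    isoNStar⇒¬adj : ∀ {v w} → T (isoNStar v) → lookup S w ≡ false → adj G v w ≡ false
    isoNStar⇒¬adj {v} {w} t w∉S = ∧≡false (cong not w∉S) (count≡0⇒ _ (proj₂ (proj₂ (isoNStar⁻ t))) w)

    isoNStar⁺ : ∀ {v} → lookup S v ≡ false →
      (∀ u → lookup S u ≡ true → adj G v u ≡ true) →
      (∀ w → lookup S w ≡ false → adj G v w ≡ false) → T (isoNStar v)
    isoNStar⁺ {v} v∉S toS fromOutside = from T-∧ (from T-not-≡ v∉S ,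
      from T-∧ (≡⇒≡ᵇ _ 0 (count-≡0 _ noNonNeighbourInS) , ≡⇒≡ᵇ _ 0 (count-≡0 _ noNeighbourOutside)))
      where
      noNonNeighbourInS : ∀ u → lookup S u ∧ not (adj G v u) ≡ false
      noNonNeighbourInS u with lookup S u in u∈S
      ... | true  rewrite toS u u∈S = refl
      ... | false = refl
      noNeighbourOutside : ∀ w → not (lookup S w) ∧ adj G v w ≡ false
      noNeighbourOutside w with lookup S w in w∈S
      ... | true  = refl
      ... | false = fromOutside w w∈S

    isoNStar-∈ₑ : ∀ e {u v} → T (isoNStar u) → T (isoNStar v) → u ∈ₑ e → v ∈ₑ e → u ≡ v
    isoNStar-∈ₑ e {u} {v} tu tv u∈e v∈e with u ≟ v
    ... | yes u≡v = u≡v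
    ... | no  u≢v = ⊥-elim (not-¬ (∈ₑ-adj e u∈e v∈e u≢v) (isoNStar⇒¬adj tu (isoNStar⇒∉ tv)))

    outsideEdge? : Fin n → Fin n → Bool
    outsideEdge? i j = (toℕ i <ᵇ toℕ j) ∧ not (lookup S i) ∧ not (lookup S j) ∧ adj G i j

    outsideEdge?⁻ : ∀ {i j} → T (outsideEdge? i j) →
      i < j × lookup S i ≡ false × lookup S j ≡ false × T (adj G i j)
    outsideEdge?⁻ t with to T-∧ t
    ... | i<j , t₁ with to T-∧ t₁
    ...   | i∉S , t₂ with to T-∧ t₂
    ...     | j∉S , ij = <ᵇ⇒< _ _ i<j , to T-not-≡ i∉S , to T-not-≡ j∉S , ij

    outsideEdge?⁺ : ∀ {i j} → i < j → lookup S i ≡ false → lookup S j ≡ false → T (adj G i j) →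
      T (outsideEdge? i j)
    outsideEdge?⁺ i<j i∉S j∉S ij = from T-∧ (<⇒<ᵇ i<j ,
      from T-∧ (from T-not-≡ i∉S , from T-∧ (from T-not-≡ j∉S , ij)))

    private
      toEdge : ∀ i → Σ (Fin n) (T ∘ outsideEdge? i) → Edge G
      toEdge i (j , t) = let i<j , _ , _ , ij = outsideEdge?⁻ {i} {j} t in (i , j) , i<j , ij

      edgesFrom : Fin n → List (Edge G)
      edgesFrom i = map (toEdge i) (witnesses (outsideEdge? i))

    outsideEdges : List (Edge G)
    outsideEdges = concatFin edgesFrom

    length-outsideEdges : length outsideEdges ≡ edgesOutside G S
    length-outsideEdges = trans (length-concatFin edgesFrom) (sumF-cong λ i →
      trans (length-map (toEdge i) (witnesses (outsideEdge? i))) (length-witnesses (outsideEdge? i)))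

    outsideEdges-Unique : Unique outsideEdges
    outsideEdges-Unique = concatFin-Unique edgesFrom
      (λ i → map⁺ (λ eq → Σ-T-≡ (cong (proj₂ ∘ proj₁) eq)) (witnesses-Unique (outsideEdge? i)))
      sameSource
      where
      sameSource : ∀ {i j e} → e ∈ edgesFrom i → e ∈ edgesFrom j → i ≡ j
      sameSource e∈i e∈j with ∈-map⁻ _ e∈i | ∈-map⁻ _ e∈j
      ... | _ , _ , e≡i | _ , _ , e≡j = cong (proj₁ ∘ proj₁) (trans (sym e≡i) e≡j)

    ∈-outsideEdges⁻ : ∀ {e x} → e ∈ outsideEdges → x ∈ₑ e → lookup S x ≡ false
    ∈-outsideEdges⁻ e∈ x∈e with ∈-concatFin⁻ edgesFrom e∈
    ... | i , e∈i with ∈-map⁻ (toEdge i) e∈i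
    ...   | (j , t) , _ , refl with outsideEdge?⁻ {i} {j} t | x∈e
    ...     | _ , i∉S , _ , _ | inj₁ refl = i∉S
    ...     | _ , _ , j∉S , _ | inj₂ refl = j∉S

    ∈-outsideEdges⁺ : ∀ e → (∀ {x} → x ∈ₑ e → lookup S x ≡ false) → e ∈ outsideEdges
    ∈-outsideEdges⁺ e@((i , j) , i<j , ij) ends∉S = subst (_∈ outsideEdges) (Edge-≡ refl)
      (∈-concatFin⁺ edgesFrom i (∈-map⁺ (toEdge i)
        (∈-witnesses (outsideEdge? i) j (outsideEdge?⁺ i<j (ends∉S (inj₁ refl)) (ends∉S (inj₂ refl)) ij))))

    Meets : Edge G → Set
    Meets e = ∃ λ x → x ∈ₑ e × lookup S x ≡ true

    outsideEdges-¬Meets : ∀ {e} → e ∈ outsideEdges → ¬ Meets e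
    outsideEdges-¬Meets e∈ (x , x∈e , x∈S) = not-¬ x∈S (∈-outsideEdges⁻ e∈ x∈e)

    Member IsoNStar : Set
    Member   = Σ (Fin n) (T ∘ lookup S)
    IsoNStar = Σ (Fin n) (T ∘ isoNStar)

    members : List Member
    members = witnesses (lookup S)

    isoNStars : List IsoNStar
    isoNStars = witnesses isoNStar

    hList : (Member → CVertex G) → (IsoNStar → CVertex G) → List (CVertex G)
    hList f g = map f members ++ map inj₂ outsideEdges ++ map g isoNStars

    length-hList : ∀ f g → length (hList f g) ≡ hValue G S
    length-hList f g = begin
      length (hList f g)
        ≡⟨ trans (length-++ (map f members))
                 (cong (length (map f members) +_) (length-++ (map inj₂ outsideEdges))) ⟩
      length (map f members) + (length (map inj₂ outsideEdges) + length (map g isoNStars))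
        ≡⟨ cong₂ _+_ (trans (length-map f members) (length-witnesses (lookup S)))
             (cong₂ _+_ (trans (length-map inj₂ outsideEdges) length-outsideEdges)
                        (trans (length-map g isoNStars) (length-witnesses isoNStar))) ⟩
      count (lookup S) + (edgesOutside G S + isolatedNStar G S)
        ≡⟨ cong (_+ (edgesOutside G S + isolatedNStar G S)) (sym (∣S∣≡count S)) ⟩
      ∣ S ∣ + (edgesOutside G S + isolatedNStar G S)
        ≡⟨ sym (+-assoc ∣ S ∣ _ _) ⟩
      hValue G S ∎
      where open ≡-Reasoning

    hList-Unique : ∀ f g →
      (∀ x y → f x ≡ f y → proj₁ x ≡ proj₁ y) →
      (∀ x y → g x ≡ g y → proj₁ x ≡ proj₁ y) →
      (∀ x {e} → e ∈ outsideEdges → f x ≢ inj₂ e) →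
      (∀ y {e} → e ∈ outsideEdges → g y ≢ inj₂ e) →
      (∀ x y → f x ≢ g y) →
      Unique (hList f g)
    hList-Unique f g f-inj g-inj f≢e g≢e f≢g =
      ++⁺ (map⁺ (Σ-T-≡ ∘ f-inj _ _) (witnesses-Unique (lookup S)))
          (++⁺ (map⁺ inj₂-injective outsideEdges-Unique)
               (map⁺ (Σ-T-≡ ∘ g-inj _ _) (witnesses-Unique isoNStar)) edges#g)
          f#rest
      where
      edges#g : ∀ {v} → ¬ (v ∈ map inj₂ outsideEdges × v ∈ map g isoNStars)
      edges#g (v∈E , v∈g) with ∈-map⁻ inj₂ v∈E | ∈-map⁻ g v∈g
      ... | e , e∈ , refl | y , _ , e≡gy = g≢e y e∈ (sym e≡gy)
      f#rest : ∀ {v} → ¬ (v ∈ map f members × v ∈ map inj₂ outsideEdges ++ map g isoNStars)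
      f#rest (v∈f , v∈rest) with ∈-map⁻ f v∈f | ∈-++⁻ (map inj₂ outsideEdges) v∈rest
      ... | x , _ , refl | inj₁ v∈E with ∈-map⁻ inj₂ v∈E
      ...   | e , e∈ , fx≡e = f≢e x e∈ fx≡e
      f#rest (v∈f , v∈rest) | x , _ , refl | inj₂ v∈g with ∈-map⁻ g v∈g
      ...   | y , _ , fx≡gy = f≢g x y fx≡gy

    upperSet : List (CVertex G)
    upperSet = hList vertexOf vertexOf

    upperSet-Unique : Unique upperSet
    upperSet-Unique = hList-Unique vertexOf vertexOf
      (λ _ _ → inj₁-injective) (λ _ _ → inj₁-injective) (λ _ _ ()) (λ _ _ ())
      (λ (x , x∈S) (y , y∈N) x≡y →
        not-¬ (to T-≡ x∈S) (trans (cong (lookup S) (inj₁-injective x≡y)) (isoNStar⇒∉ y∈N)))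

    private
      S⊆upperSet : ∀ {v} → lookup S v ≡ true → inj₁ v ∈ upperSet
      S⊆upperSet {v} v∈S = ∈-++⁺ˡ (∈-map⁺ vertexOf (∈-witnesses (lookup S) v (from T-≡ v∈S)))

      outsideEdges⊆upperSet : ∀ {e} → e ∈ outsideEdges → inj₂ e ∈ upperSet
      outsideEdges⊆upperSet e∈ = ∈-++⁺ʳ (map vertexOf members) (∈-++⁺ˡ (∈-map⁺ inj₂ e∈))

      isoNStars⊆upperSet : ∀ {v} → T (isoNStar v) → inj₁ v ∈ upperSet
      isoNStars⊆upperSet {v} t =
        ∈-++⁺ʳ (map vertexOf members) (∈-++⁺ʳ (map inj₂ outsideEdges) (∈-map⁺ vertexOf (∈-witnesses isoNStar v t)))

    length-upperSet : length upperSet ≡ hValue G S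
    length-upperSet = length-hList vertexOf vertexOf

    -- A vertex outside S is dominated by a non-neighbour in S, or by the subdivision vertex of an
    -- edge of G − S at it; if neither exists, it is counted by i(N*(S)).
    upperSet-Dominating : Dominating (CAdj G) upperSet
    upperSet-Dominating (inj₁ v) with lookup S v in v∈S?
    ... | true  = inj₁ (S⊆upperSet v∈S?)
    ... | false with any? (λ u → (lookup S u ≟ᵇ true) ×-dec (adj G v u ≟ᵇ false))
    ...   | yes (u , u∈S , ¬vu) =
      inj₂ (inj₁ u , S⊆upperSet u∈S , (λ { refl → not-¬ u∈S v∈S? }) , trans (Graph.sym G u v) ¬vu)
    ...   | no allInS with any? (λ w → (lookup S w ≟ᵇ false) ×-dec (adj G v w ≟ᵇ true))
    ...     | yes (w , w∉S , vw) =
      let e , v∈e , w∈e = edgeBetween v w vw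
          ends∉S : ∀ {x} → x ∈ₑ e → lookup S x ≡ false
          ends∉S x∈e = [ (λ { refl → v∈S? }) , (λ { refl → w∉S }) ]′ (∈ₑ-two e x∈e v∈e w∈e (adj⇒≢ vw))
      in inj₂ (inj₂ e , outsideEdges⊆upperSet (∈-outsideEdges⁺ e ends∉S) , ∈ₑ⇒CAdj e v∈e)
    ...     | no noneOutside = inj₁ (isoNStars⊆upperSet (isoNStar⁺ v∈S?
      (λ u u∈S → ¬-not λ vu → allInS (u , u∈S , vu))
      (λ w w∉S → ¬-not λ vw → noneOutside (w , w∉S , vw))))
    upperSet-Dominating (inj₂ e@((i , j) , _)) with lookup S i in i∈S? | lookup S j in j∈S?
    ... | true  | _     = inj₂ (inj₁ i , S⊆upperSet i∈S? , inj₁ refl)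
    ... | false | true  = inj₂ (inj₁ j , S⊆upperSet j∈S? , inj₂ refl)
    ... | false | false =
      inj₁ (outsideEdges⊆upperSet (∈-outsideEdges⁺ e λ { (inj₁ refl) → i∈S? ; (inj₂ refl) → j∈S? }))

    -- Distinct objects get distinct charges because edges of G − S meet no vertex of S and no edge
    -- joins two vertices counted by i(N*(S)).
    record Charging (D : List (CVertex G)) : Set where
      field
        chargeS           : Member → CVertex G
        chargeS-∈         : ∀ x → chargeS x ∈ D
        chargeS-injective : ∀ x y → chargeS x ≡ chargeS y → proj₁ x ≡ proj₁ y
        chargeS-edge      : ∀ x {e} → chargeS x ≡ inj₂ e → Meets e × (∀ {y} → y ∈ₑ e → ¬ T (isoNStar y))
        outsideEdges-∈    : ∀ {e} → e ∈ outsideEdges → inj₂ e ∈ D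
        chargeN           : IsoNStar → Edge G
        chargeN-∈         : ∀ x → inj₂ (chargeN x) ∈ D
        chargeN-∋         : ∀ x → proj₁ x ∈ₑ chargeN x
        chargeN-meets     : ∀ x → Meets (chargeN x)

    hValue≤length : ∀ {D} → Unique D → Charging D → hValue G S ≤ length D
    hValue≤length {D} !D charging =
      subst (_≤ length D) (length-hList chargeS (inj₂ ∘ chargeN)) (Unique-⊆⇒length≤ !hList hList⊆D)
      where
      open Charging charging
      !hList : Unique (hList chargeS (inj₂ ∘ chargeN))
      !hList = hList-Unique chargeS (inj₂ ∘ chargeN) chargeS-injective
        (λ (u , tu) (v , tv) eq → isoNStar-∈ₑ (chargeN (v , tv)) tu tv
                                   (subst (u ∈ₑ_) (inj₂-injective eq) (chargeN-∋ (u , tu))) (chargeN-∋ (v , tv)))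
        (λ x e∈ fx≡e → outsideEdges-¬Meets e∈ (proj₁ (chargeS-edge x fx≡e)))
        (λ y e∈ gy≡e → outsideEdges-¬Meets e∈ (subst Meets (inj₂-injective gy≡e) (chargeN-meets y)))
        (λ x (v , tv) fx≡gy → proj₂ (chargeS-edge x fx≡gy) (chargeN-∋ (v , tv)) tv)
      hList⊆D : hList chargeS (inj₂ ∘ chargeN) ⊆ D
      hList⊆D v∈ with ∈-++⁻ (map chargeS members) v∈
      ... | inj₁ v∈S with ∈-map⁻ chargeS v∈S
      ...   | x , _ , refl = chargeS-∈ x
      hList⊆D v∈ | inj₂ v∈rest with ∈-++⁻ (map inj₂ outsideEdges) v∈rest
      ... | inj₁ v∈E with ∈-map⁻ inj₂ v∈E
      ...   | e , e∈ , refl = outsideEdges-∈ e∈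
      hList⊆D v∈ | inj₂ v∈rest | inj₂ v∈N with ∈-map⁻ (inj₂ ∘ chargeN) v∈N
      ...   | y , _ , refl = chargeN-∈ y

  inj₁≟ : (i : Fin n) (x : CVertex G) → Dec (inj₁ i ≡ x)
  inj₁≟ i (inj₁ j) = map′ (cong inj₁) inj₁-injective (i ≟ j)
  inj₁≟ i (inj₂ _) = no λ ()

  vertexSet : List (CVertex G) → Subset n
  vertexSet D = tabulate λ i → does (Any.any? (inj₁≟ i) D)

  vertexSet⁺ : ∀ {D i} → inj₁ i ∈ D → lookup (vertexSet D) i ≡ true
  vertexSet⁺ {D} {i} i∈D = trans (lookup∘tabulate _ i) (dec-true (Any.any? (inj₁≟ i) D) i∈D)

  vertexSet⁻ : ∀ {D i} → lookup (vertexSet D) i ≡ true → inj₁ i ∈ D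
  vertexSet⁻ {D} {i} i∈S with Any.any? (inj₁≟ i) D
  ... | yes i∈D = i∈D
  ... | no  i∉D = ⊥-elim (not-¬ i∈S (trans (lookup∘tabulate _ i) (dec-false (Any.any? (inj₁≟ i) D) i∉D)))

  module _ {D : List (CVertex G)} (dom : Dominating (CAdj G) D) where

    chargingVertexSet : Charging (vertexSet D) D
    chargingVertexSet = record
      { chargeS           = vertexOf
      ; chargeS-∈         = λ (v , t) → vertexSet⁻ (to T-≡ t)
      ; chargeS-injective = λ _ _ → inj₁-injective
      ; chargeS-edge      = λ _ ()
      ; outsideEdges-∈    = outsideEdge∈D
      ; chargeN           = proj₁ ∘ dominatingEdge
      ; chargeN-∈         = proj₁ ∘ proj₂ ∘ dominatingEdge
      ; chargeN-∋         = proj₂ ∘ proj₂ ∘ dominatingEdge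
      ; chargeN-meets     = dominatingEdge-meets
      }
      where
      S : Subset n
      S = vertexSet D
      outsideEdge∈D : ∀ {e} → e ∈ outsideEdges S → inj₂ e ∈ D
      outsideEdge∈D {e} e∈ with dom (inj₂ e)
      ... | inj₁ e∈D = e∈D
      ... | inj₂ (inj₁ w , w∈D , w∈e) =
        ⊥-elim (not-¬ (vertexSet⁺ w∈D) (∈-outsideEdges⁻ S e∈ (CAdj⇒∈ₑ′ e w∈e)))
      ... | inj₂ (inj₂ _ , _ , ())
      dominatingEdge : (x : IsoNStar S) → Σ (Edge G) λ e → inj₂ e ∈ D × proj₁ x ∈ₑ e
      dominatingEdge (v , t) with dom (inj₁ v)
      ... | inj₁ v∈D = ⊥-elim (not-¬ (vertexSet⁺ v∈D) (isoNStar⇒∉ S t))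
      ... | inj₂ (inj₁ w , w∈D , _ , ¬wv) =
        ⊥-elim (not-¬ (adj-sym (isoNStar⇒adj S t (vertexSet⁺ w∈D))) ¬wv)
      ... | inj₂ (inj₂ e , e∈D , e∋v) = e , e∈D , CAdj⇒∈ₑ e e∋v
      dominatingEdge-meets : ∀ x → Meets S (proj₁ (dominatingEdge x))
      dominatingEdge-meets x@(v , t) with otherEnd (proj₁ (dominatingEdge x)) (proj₂ (proj₂ (dominatingEdge x)))
      ... | y , y∈e , vy with lookup S y in y∈S?
      ...   | true  = y , y∈e , y∈S?
      ...   | false = ⊥-elim (not-¬ vy (isoNStar⇒¬adj S t y∈S?))

  module _ {D : List (CVertex G)} (dom : Dominating (CAdj G) D) (noVertex : ¬ ∃ λ i → inj₁ i ∈ D) where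

    edges∈D : ∀ e → inj₂ e ∈ D
    edges∈D e with dom (inj₂ e)
    ... | inj₁ e∈D = e∈D
    ... | inj₂ (inj₁ w , w∈D , _) = ⊥-elim (noVertex (w , w∈D))
    ... | inj₂ (inj₂ _ , _ , ())

    hasNeighbour : ∀ v → ∃ λ w → adj G v w ≡ true
    hasNeighbour v with dom (inj₁ v)
    ... | inj₁ v∈D = ⊥-elim (noVertex (v , v∈D))
    ... | inj₂ (inj₁ w , w∈D , _) = ⊥-elim (noVertex (w , w∈D))
    ... | inj₂ (inj₂ e , _ , e∋v) = let w , _ , vw = otherEnd e (CAdj⇒∈ₑ e e∋v) in w , vw

  module _ {D : List (CVertex G)} (edges∈D : ∀ e → inj₂ e ∈ D) where

    chargingPath : ∀ {p q r} → adj G p q ≡ true → adj G q r ≡ true → p ≢ r → Charging ⁅ p ⁆ D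
    chargingPath {p} {q} {r} pq qr p≢r = record
      { chargeS           = λ _ → inj₂ e
      ; chargeS-∈         = λ _ → edges∈D e
      ; chargeS-injective = λ (u , tu) (v , tv) _ → trans (∈S⇒≡p tu) (sym (∈S⇒≡p tv))
      ; chargeS-edge      = λ { _ refl → (p , p∈e , lookup-⁅x⁆ p) , ends-¬isoNStar }
      ; outsideEdges-∈    = λ _ → edges∈D _
      ; chargeN           = λ (u , t) → proj₁ (toP t)
      ; chargeN-∈         = λ _ → edges∈D _
      ; chargeN-∋         = λ (u , t) → proj₁ (proj₂ (toP t))
      ; chargeN-meets     = λ (u , t) → p , proj₂ (proj₂ (toP t)) , lookup-⁅x⁆ p
      }
      where
      S : Subset n
      S = ⁅ p ⁆
      e : Edge G
      e = proj₁ (edgeBetween p q pq)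
      p∈e : p ∈ₑ e
      p∈e = proj₁ (proj₂ (edgeBetween p q pq))
      q∈e : q ∈ₑ e
      q∈e = proj₂ (proj₂ (edgeBetween p q pq))
      ∈S⇒≡p : ∀ {u} → T (lookup S u) → u ≡ p
      ∈S⇒≡p t = lookup-⁅y⁆ p (to T-≡ t)
      toP : ∀ {u} → T (isoNStar S u) → Σ (Edge G) λ e → u ∈ₑ e × p ∈ₑ e
      toP {u} t = edgeBetween u p (isoNStar⇒adj S t (lookup-⁅x⁆ p))
      ends-¬isoNStar : ∀ {y} → y ∈ₑ e → ¬ T (isoNStar S y)
      ends-¬isoNStar y∈e t with ∈ₑ-two e y∈e p∈e q∈e (adj⇒≢ pq)
      ... | inj₁ refl = not-¬ (lookup-⁅x⁆ p) (isoNStar⇒∉ S t)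
      ... | inj₂ refl = not-¬ qr (isoNStar⇒¬adj S t (¬-not λ r∈S → p≢r (sym (lookup-⁅y⁆ p r∈S))))

    chargingMatching : (∀ {p q r} → adj G p q ≡ true → adj G q r ≡ true → p ≡ r) →
      ∀ {a b c d} → adj G a b ≡ true → adj G c d ≡ true → c ≢ a → c ≢ b → Charging (⁅ a ⁆ ∪ ⁅ c ⁆) D
    chargingMatching noTwoPath {a} {b} {c} {d} ab cd c≢a c≢b = record
      { chargeS           = λ (v , _) → inj₂ (pick (v ≟ a))
      ; chargeS-∈         = λ _ → edges∈D _
      ; chargeS-injective = λ (u , tu) (v , tv) → pick-injective (u ≟ a) (v ≟ a) (∈S tu) (∈S tv) ∘ inj₂-injective
      ; chargeS-edge      = λ (v , _) eq → subst (Meets S) (inj₂-injective eq) (pick-meets (v ≟ a)) , λ _ → ¬isoNStar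
      ; outsideEdges-∈    = λ _ → edges∈D _
      ; chargeN           = λ (_ , t) → ⊥-elim (¬isoNStar t)
      ; chargeN-∈         = λ (_ , t) → ⊥-elim (¬isoNStar t)
      ; chargeN-∋         = λ (_ , t) → ⊥-elim (¬isoNStar t)
      ; chargeN-meets     = λ (_ , t) → ⊥-elim (¬isoNStar t)
      }
      where
      S : Subset n
      S = ⁅ a ⁆ ∪ ⁅ c ⁆
      a∈S : lookup S a ≡ true
      a∈S = lookup-∪⁺ˡ ⁅ a ⁆ ⁅ c ⁆ (lookup-⁅x⁆ a)
      c∈S : lookup S c ≡ true
      c∈S = lookup-∪⁺ʳ ⁅ a ⁆ ⁅ c ⁆ (lookup-⁅x⁆ c)
      ∈S : ∀ {v} → T (lookup S v) → v ≡ a ⊎ v ≡ c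
      ∈S t with lookup-∪⁻ ⁅ a ⁆ ⁅ c ⁆ (to T-≡ t)
      ... | inj₁ v∈a = inj₁ (lookup-⁅y⁆ a v∈a)
      ... | inj₂ v∈c = inj₂ (lookup-⁅y⁆ c v∈c)
      ¬isoNStar : ∀ {u} → ¬ T (isoNStar S u)
      ¬isoNStar t = c≢a (sym (noTwoPath (adj-sym (isoNStar⇒adj S t a∈S)) (isoNStar⇒adj S t c∈S)))
      eAB : Σ (Edge G) λ e → a ∈ₑ e × b ∈ₑ e
      eAB = edgeBetween a b ab
      eCD : Σ (Edge G) λ e → c ∈ₑ e × d ∈ₑ e
      eCD = edgeBetween c d cd
      pick : ∀ {v} → Dec (v ≡ a) → Edge G
      pick (yes _) = proj₁ eAB
      pick (no _)  = proj₁ eCD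
      pick-meets : ∀ {v} (v≟a : Dec (v ≡ a)) → Meets S (pick v≟a)
      pick-meets (yes _) = a , proj₁ (proj₂ eAB) , a∈S
      pick-meets (no _)  = c , proj₁ (proj₂ eCD) , c∈S
      a∉CD : ¬ a ∈ₑ proj₁ eCD
      a∉CD a∈ with ∈ₑ-two (proj₁ eCD) a∈ (proj₁ (proj₂ eCD)) (proj₂ (proj₂ eCD)) (adj⇒≢ cd)
      ... | inj₁ a≡c = c≢a (sym a≡c)
      ... | inj₂ refl = c≢b (sym (noTwoPath (adj-sym ab) (adj-sym cd)))
      pick-injective : ∀ {u v} (u≟a : Dec (u ≡ a)) (v≟a : Dec (v ≡ a)) →
        u ≡ a ⊎ u ≡ c → v ≡ a ⊎ v ≡ c → pick u≟a ≡ pick v≟a → u ≡ v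
      pick-injective (yes u≡a) (yes v≡a) _ _ _ = trans u≡a (sym v≡a)
      pick-injective (yes _) (no _) _ _ eq = ⊥-elim (a∉CD (subst (a ∈ₑ_) eq (proj₁ (proj₂ eAB))))
      pick-injective (no _) (yes _) _ _ eq = ⊥-elim (a∉CD (subst (a ∈ₑ_) (sym eq) (proj₁ (proj₂ eAB))))
      pick-injective (no u≢a) (no v≢a) u∈S v∈S _ =
        trans ([ ⊥-elim ∘ u≢a , id ]′ u∈S) (sym ([ ⊥-elim ∘ v≢a , id ]′ v∈S))

  TwoPath : Set
  TwoPath = ∃ λ p → ∃ λ q → ∃ λ r → adj G p q ≡ true × adj G q r ≡ true × p ≢ r

  twoPath? : Dec TwoPath
  twoPath? = any? λ p → any? λ q → any? λ r →
    (adj G p q ≟ᵇ true) ×-dec (adj G q r ≟ᵇ true) ×-dec (¬? (p ≟ r))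

  ¬TwoPath⇒ : ¬ TwoPath → ∀ {p q r} → adj G p q ≡ true → adj G q r ≡ true → p ≡ r
  ¬TwoPath⇒ ¬path {p} {q} {r} pq qr with p ≟ r
  ... | yes p≡r = p≡r
  ... | no  p≢r = ⊥-elim (¬path (p , q , r , pq , qr , p≢r))

distinctFromZeroAnd : ∀ {m} (x : Fin (3 + m)) → ∃ λ c → c ≢ zero × c ≢ x
distinctFromZeroAnd x with suc zero ≟ x
... | no 1≢x   = suc zero , (λ ()) , 1≢x
... | yes refl = suc (suc zero) , (λ ()) , (λ ())

distinctFromTwo : ∀ {m} (a b : Fin (3 + m)) → ∃ λ c → c ≢ a × c ≢ b
distinctFromTwo a b with zero ≟ a | zero ≟ b
... | no 0≢a   | no 0≢b   = zero , 0≢a , 0≢b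
... | yes refl | _        = distinctFromZeroAnd b
... | no _     | yes refl = let c , c≢0 , c≢a = distinctFromZeroAnd a in c , c≢a , c≢0

lowerBound-allEdges : ∀ {m} (G : Graph (3 + m)) {D : List (CVertex G)} → Unique D →
  (∀ e → inj₂ e ∈ D) → (∀ v → ∃ λ w → adj G v w ≡ true) → ∃ λ S → Nonempty S × hValue G S ≤ length D
lowerBound-allEdges G !D edges∈D hasNeighbour with twoPath? G
... | yes (p , q , r , pq , qr , p≢r) =
  ⁅ p ⁆ , (p , x∈⁅x⁆ p) , hValue≤length G _ !D (chargingPath G edges∈D pq qr p≢r)
... | no ¬path =
  let a = zero
      b , ab = hasNeighbour a
      c , c≢a , c≢b = distinctFromTwo a b
      d , cd = hasNeighbour c
  in ⁅ a ⁆ ∪ ⁅ c ⁆ , (a , x∈p∪q⁺ (inj₁ (x∈⁅x⁆ a))) ,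
     hValue≤length G _ !D (chargingMatching G edges∈D (¬TwoPath⇒ G ¬path) ab cd c≢a c≢b)

lowerBound : ∀ {m} (G : Graph (3 + m)) (D : List (CVertex G)) → Dominating (CAdj G) D → Unique D →
  ∃ λ S → Nonempty S × hValue G S ≤ length D
lowerBound G D dom !D with any? (λ i → Any.any? (inj₁≟ G i) D)
... | yes (i , i∈D) =
  vertexSet G D , (i , lookup⇒[]= i _ (vertexSet⁺ G i∈D)) , hValue≤length G _ !D (chargingVertexSet G dom)
... | no noVertex = lowerBound-allEdges G !D (edges∈D G dom noVertex) (hasNeighbour G dom noVertex)

theorem2p4 : (n : ℕ) → 3 ≤ n → (G : Graph n) →
    (∀ ℓ → 3 ≤ ℓ → ℓ ≤ n → ¬ (G ≅ KUnion n ℓ)) →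
    ∃[ k ] (IsDominationNumber (CAdj G) k × IsH G k)
theorem2p4 (suc (suc (suc m))) (s≤s (s≤s (s≤s _))) G _ with argmin-Subset nonempty? (hValue G)
... | inj₁ allEmpty = ⊥-elim (allEmpty ⁅ zero ⁆ (zero , x∈⁅x⁆ zero))
... | inj₂ (S₀ , S₀≢∅ , minimal) = hValue G S₀ , (attained , belowAll) , (S₀ , S₀≢∅ , refl) , minimal
  where
  attained : ∃[ D ] (Dominating (CAdj G) D × Unique D × length D ≡ hValue G S₀)
  attained = upperSet G S₀ , upperSet-Dominating G S₀ , upperSet-Unique G S₀ , length-upperSet G S₀
  belowAll : ∀ D → Dominating (CAdj G) D → Unique D → hValue G S₀ ≤ length D
  belowAll D dom !D = let S , S≢∅ , hS≤D = lowerBound G D dom !D in ≤-trans (minimal S S≢∅) hS≤D
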